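{- Let $\Gamma$ and $\Gamma'$ be finite multisets of formulas with $\Gamma'\succeq\Gamma$. For any formula $F$, if $\Gamma\longrightarrow F$ has an I-proof then $\Gamma'\longrightarrow F$ has an I-proof. For any finite multiset $\Delta$ of formulas, if $\Gamma\longrightarrow\Delta$ has a C-proof $\Xi$, then $\Gamma'\longrightarrow\Delta$ has a C-proof whose nonconstructiveness measure is at most $\mu(\Xi)$.
   Context: Formulas are first-order with logical symbols $\top,\bot,\land,\lor,\supset,\exists,\forall$; $\top,\bot$ are not atomic. A sequent $\Gamma\longrightarrow\Delta$ is a pair of finite multisets of formulas. A C-proof is a derivation in the classical multiple-succedent sequent calculus whose axioms are sequents with $\top\in\Delta$ or with some $A$ ($\bot$ or atomic) in both $\Gamma$ and $\Delta$, and whose rules are: contr-L ($B,B,\Gamma\longrightarrow\Delta\Rightarrow B,\Gamma\longrightarrow\Delta$), contr-R ($\Gamma\longrightarrow\Delta,B,B\Rightarrow\Gamma\longrightarrow\Delta,B$), $\bot$-R ($\Gamma\longrightarrow\Delta,\bot\Rightarrow\Gamma\longrightarrow\Delta,D$), $\land$-L ($B,D,B\land D,\Gamma\longrightarrow\Delta\Rightarrow B\land D,\Gamma\longrightarrow\Delta$), $\land$-R ($\Gamma\longrightarrow\Delta,B$ and $\Gamma\longrightarrow\Delta,D\Rightarrow\Gamma\longrightarrow\Delta,B\land D$), $\lor$-L ($B,\Gamma\longrightarrow\Delta$ and $D,\Gamma\longrightarrow\Delta\Rightarrow B\lor D,\Gamma\longrightarrow\Delta$), $\lor$-R ($\Gamma\longrightarrow\Delta,B$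 or $\Gamma\longrightarrow\Delta,D\Rightarrow\Gamma\longrightarrow\Delta,B\lor D$), $\supset$-L ($B\supset D,\Gamma\longrightarrow B,\Delta$ and $D,\Gamma\longrightarrow\Theta\Rightarrow B\supset D,\Gamma\longrightarrow\Delta,\Theta$), $\supset$-R ($B,\Gamma\longrightarrow\Delta,D\Rightarrow\Gamma\longrightarrow\Delta,B\supset D$), $\forall$-L ($[t/x]B,\forall xB,\Gamma\longrightarrow\Delta\Rightarrow\forall xB,\Gamma\longrightarrow\Delta$), $\exists$-R ($\Gamma\longrightarrow\Delta,[t/x]B\Rightarrow\Gamma\longrightarrow\Delta,\exists xB$), $\exists$-L ($[c/x]B,\Gamma\longrightarrow\Delta\Rightarrow\exists xB,\Gamma\longrightarrow\Delta$), $\forall$-R ($\Gamma\longrightarrow\Delta,[c/x]B\Rightarrow\Gamma\longrightarrow\Delta,\forall xB$), $c$ a constant not in the lower sequent. An I-proof is a C-proof in which every sequent has exactly one succedent formula. In a C-proof $\Xi$, an occurrence of $\lor$-L with lower sequent $B\lor D,\Gamma\longrightarrow\Delta$ is nonconstructive if there is no $F\in\Delta$ such that both $B,\Gamma\longrightarrow F$ and $D,\Gamma\longrightarrow F$ have I-proofs; an occurrence of $\supset$-R with upper sequent $B,\Gamma\longrightarrow\Delta,D$ is nonconstructive if $B,\Gamma\longrightarrow D$ has no I-proof; $\mu(\Xi)$ is the number of nonconstructive occurrences of $\lor$-L and $\supset$-R rules in $\Xi$. The relation $\succeq$: $F_1\succeq F_2$ iff $F_1=F_2$, or $F_2$ is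 $A\supset B$ and $F_1\succeq B$, or $F_2$ is $A\lor B$ and ($F_1\succeq A$ or $F_1\succeq B$), or $F_2$ is $\exists xP$ and $F_1\succeq[c/x]P$ for some constant $c$; for multisets, $\Gamma_1\succeq\Gamma_2$ iff there is a one-to-one $\kappa:\Gamma_2\to\Gamma_1$ with $\kappa(F)\succeq F$. -}

module Defs where

open import Data.Nat using (ℕ; zero; suc; _≤_; _+_; _<ᵇ_; _≡ᵇ_; pred)
open import Data.Bool using (Bool; true; false; if_then_else_)
open import Data.List using (List; []; _∷_; _++_; [_]; length; lookup)
open import Data.List.Membership.Propositional using (_∈_)
open import Data.List.Relation.Unary.Any using (Any)
open import Data.List.Relation.Binary.Permutation.Propositional using (_↭_)
open import Data.Fin using (Fin)
open import Data.Empty using (⊥)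
open import Data.Unit using (⊤)
open import Data.Sum using (_⊎_)
open import Data.Product using (Σ; _×_)
open import Relation.Binary.PropositionalEquality using (_≡_)
open import Relation.Nullary using (¬_)
open import Function.Definitions using (Injective)

-- Syntax: first-order terms and formulas (bound variables as de Bruijn
-- indices; constants and function/predicate symbols named by ℕ).

data Term : Set where
  var : ℕ → Term
  con : ℕ → Term
  fun : ℕ → List Term → Term

data Formula : Set where
  atom  : ℕ → List Term → Formula
  `⊤ `⊥ : Formula
  _`∧_ _`∨_ _`⊃_ : Formula → Formula → Formula
  `∃ `∀ : Formula → Formula         -- body binds de Bruijn index 0

infixr 6 _`∧_
infixr 5 _`∨_
infixr 4 _`⊃_

mutual
  ClosedT : Term → Set
  ClosedT (var _)    = ⊥
  ClosedT (con _)    = ⊤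
  ClosedT (fun _ ts) = ClosedTs ts

  ClosedTs : List Term → Set
  ClosedTs []       = ⊤
  ClosedTs (t ∷ ts) = ClosedT t × ClosedTs ts

-- Replace bound variable d by the (closed) term s.
mutual
  substT : ℕ → Term → Term → Term
  substT d s (var n)    = if n ≡ᵇ d then s else (if n <ᵇ d then var n else var (pred n))
  substT d s (con c)    = con c
  substT d s (fun f ts) = fun f (substTs d s ts)

  substTs : ℕ → Term → List Term → List Term
  substTs d s []       = []
  substTs d s (t ∷ ts) = substT d s t ∷ substTs d s ts

substF : ℕ → Term → Formula → Formula
substF d s (atom p ts) = atom p (substTs d s ts)
substF d s `⊤          = `⊤
substF d s `⊥          = `⊥
substF d s (A `∧ B)    = substF d s A `∧ substF d s B
substF d s (A `∨ B)    = substF d s A `∨ substF d s B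
substF d s (A `⊃ B)    = substF d s A `⊃ substF d s B
substF d s (`∃ A)      = `∃ (substF (suc d) s A)
substF d s (`∀ A)      = `∀ (substF (suc d) s A)

[_/x]_ : Term → Formula → Formula
[ t /x] B = substF 0 t B

mutual
  OccT : ℕ → Term → Set
  OccT c (var _)    = ⊥
  OccT c (con d)    = c ≡ d
  OccT c (fun _ ts) = OccTs c ts

  OccTs : ℕ → List Term → Set
  OccTs c []       = ⊥
  OccTs c (t ∷ ts) = OccT c t ⊎ OccTs c ts

OccF : ℕ → Formula → Set
OccF c (atom _ ts) = OccTs c ts
OccF c `⊤          = ⊥
OccF c `⊥          = ⊥
OccF c (A `∧ B)    = OccF c A ⊎ OccF c B
OccF c (A `∨ B)    = OccF c A ⊎ OccF c B
OccF c (A `⊃ B)    = OccF c A ⊎ OccF c B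
OccF c (`∃ A)      = OccF c A
OccF c (`∀ A)      = OccF c A

_#_ : ℕ → List Formula → Set
c # Γ = ¬ Any (OccF c) Γ

data BotOrAtom : Formula → Set where
  isBot  : BotOrAtom `⊥
  isAtom : ∀ p ts → BotOrAtom (atom p ts)

-- C-proofs.  Multisets are lists; the two exchange rules make a
-- derivation of Γ ⟶ Δ depend only on the multisets underlying Γ, Δ.
-- The principal formula of each rule is written at the head.

infix 2 _⟶_

data _⟶_ : List Formula → List Formula → Set where
  ax-⊤   : ∀ {Γ Δ} → `⊤ ∈ Δ → Γ ⟶ Δ
  ax     : ∀ {Γ Δ A} → BotOrAtom A → A ∈ Γ → A ∈ Δ → Γ ⟶ Δ
  exch-L : ∀ {Γ Γ' Δ} → Γ ↭ Γ' → Γ ⟶ Δ → Γ' ⟶ Δ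
  exch-R : ∀ {Γ Δ Δ'} → Δ ↭ Δ' → Γ ⟶ Δ → Γ ⟶ Δ'
  contr-L : ∀ {Γ Δ B} → B ∷ B ∷ Γ ⟶ Δ → B ∷ Γ ⟶ Δ
  contr-R : ∀ {Γ Δ B} → Γ ⟶ B ∷ B ∷ Δ → Γ ⟶ B ∷ Δ
  ⊥-R    : ∀ {Γ Δ D} → Γ ⟶ `⊥ ∷ Δ → Γ ⟶ D ∷ Δ
  ∧-L    : ∀ {Γ Δ B D} → B ∷ D ∷ (B `∧ D) ∷ Γ ⟶ Δ → (B `∧ D) ∷ Γ ⟶ Δ
  ∧-R    : ∀ {Γ Δ B D} → Γ ⟶ B ∷ Δ → Γ ⟶ D ∷ Δ → Γ ⟶ (B `∧ D) ∷ Δ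
  ∨-L    : ∀ {Γ Δ B D} → B ∷ Γ ⟶ Δ → D ∷ Γ ⟶ Δ → (B `∨ D) ∷ Γ ⟶ Δ
  ∨-R₁   : ∀ {Γ Δ B D} → Γ ⟶ B ∷ Δ → Γ ⟶ (B `∨ D) ∷ Δ
  ∨-R₂   : ∀ {Γ Δ B D} → Γ ⟶ D ∷ Δ → Γ ⟶ (B `∨ D) ∷ Δ
  ⊃-L    : ∀ {Γ Δ Θ B D} → (B `⊃ D) ∷ Γ ⟶ B ∷ Δ → D ∷ Γ ⟶ Θ
           → (B `⊃ D) ∷ Γ ⟶ Δ ++ Θ
  ⊃-R    : ∀ {Γ Δ B D} → B ∷ Γ ⟶ D ∷ Δ → Γ ⟶ (B `⊃ D) ∷ Δ
  ∀-L    : ∀ {Γ Δ B} (t : Term) → ClosedT t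
           → ([ t /x] B) ∷ (`∀ B) ∷ Γ ⟶ Δ → (`∀ B) ∷ Γ ⟶ Δ
  ∃-R    : ∀ {Γ Δ B} (t : Term) → ClosedT t
           → Γ ⟶ ([ t /x] B) ∷ Δ → Γ ⟶ (`∃ B) ∷ Δ
  ∃-L    : ∀ {Γ Δ B} (c : ℕ) → c # ((`∃ B) ∷ Γ) → c # Δ
           → ([ con c /x] B) ∷ Γ ⟶ Δ → (`∃ B) ∷ Γ ⟶ Δ
  ∀-R    : ∀ {Γ Δ B} (c : ℕ) → c # Γ → c # ((`∀ B) ∷ Δ)
           → Γ ⟶ ([ con c /x] B) ∷ Δ → Γ ⟶ (`∀ B) ∷ Δ

IsI : ∀ {Γ Δ} → Γ ⟶ Δ → Set
IsI {Δ = Δ} Ξ = length Δ ≡ 1 × Below Ξ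
  where
  Below : ∀ {Γ Δ} → Γ ⟶ Δ → Set
  Below (ax-⊤ _)        = ⊤
  Below (ax _ _ _)      = ⊤
  Below (exch-L _ p)    = IsI p
  Below (exch-R _ p)    = IsI p
  Below (contr-L p)     = IsI p
  Below (contr-R p)     = IsI p
  Below (⊥-R p)         = IsI p
  Below (∧-L p)         = IsI p
  Below (∧-R p q)       = IsI p × IsI q
  Below (∨-L p q)       = IsI p × IsI q
  Below (∨-R₁ p)        = IsI p
  Below (∨-R₂ p)        = IsI p
  Below (⊃-L p q)       = IsI p × IsI q
  Below (⊃-R p)         = IsI p
  Below (∀-L _ _ p)     = IsI p
  Below (∃-R _ _ p)     = IsI p
  Below (∃-L _ _ _ p)   = IsI p
  Below (∀-R _ _ _ p)   = IsI p

HasIProof : List Formula → Formula → Set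
HasIProof Γ F = Σ (Γ ⟶ [ F ]) IsI

ConstrOr : List Formula → List Formula → Formula → Formula → Set
ConstrOr Γ Δ B D = Σ Formula λ F → F ∈ Δ × HasIProof (B ∷ Γ) F × HasIProof (D ∷ Γ) F

ConstrImp : List Formula → Formula → Formula → Set
ConstrImp Γ B D = HasIProof (B ∷ Γ) D

-- Since constructiveness of an occurrence is not decidable,
-- μ is given as an upper-bound relation: μ≤ Ξ k holds iff one can
-- certify constructiveness of enough ∨-L / ⊃-R occurrences so that
-- (number of uncertified occurrences) ≤ k.  Classically this is exactly
-- μ(Ξ) ≤ k.

data μ≤ : ∀ {Γ Δ} → Γ ⟶ Δ → ℕ → Set where
  ax-⊤   : ∀ {Γ Δ} {h : `⊤ ∈ Δ} {k} → μ≤ {Γ} (ax-⊤ h) k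
  ax     : ∀ {Γ Δ A} {a : BotOrAtom A} {i : A ∈ Γ} {j : A ∈ Δ} {k}
           → μ≤ {Γ} {Δ} (ax a i j) k
  exch-L : ∀ {Γ Γ' Δ} {π : Γ ↭ Γ'} {p : Γ ⟶ Δ} {k} → μ≤ p k → μ≤ (exch-L π p) k
  exch-R : ∀ {Γ Δ Δ'} {π : Δ ↭ Δ'} {p : Γ ⟶ Δ} {k} → μ≤ p k → μ≤ (exch-R π p) k
  contr-L : ∀ {Γ Δ B} {p : B ∷ B ∷ Γ ⟶ Δ} {k} → μ≤ p k → μ≤ (contr-L p) k
  contr-R : ∀ {Γ Δ B} {p : Γ ⟶ B ∷ B ∷ Δ} {k} → μ≤ p k → μ≤ (contr-R p) k
  ⊥-R    : ∀ {Γ Δ D} {p : Γ ⟶ `⊥ ∷ Δ} {k} → μ≤ p k → μ≤ (⊥-R {D = D} p) k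
  ∧-L    : ∀ {Γ Δ B D} {p : B ∷ D ∷ (B `∧ D) ∷ Γ ⟶ Δ} {k} → μ≤ p k → μ≤ (∧-L p) k
  ∧-R    : ∀ {Γ Δ B D} {p : Γ ⟶ B ∷ Δ} {q : Γ ⟶ D ∷ Δ} {k l}
           → μ≤ p k → μ≤ q l → μ≤ (∧-R p q) (k + l)
  ∨-L-c  : ∀ {Γ Δ B D} {p : B ∷ Γ ⟶ Δ} {q : D ∷ Γ ⟶ Δ} {k l}
           → ConstrOr Γ Δ B D → μ≤ p k → μ≤ q l → μ≤ (∨-L p q) (k + l)
  ∨-L-n  : ∀ {Γ Δ B D} {p : B ∷ Γ ⟶ Δ} {q : D ∷ Γ ⟶ Δ} {k l}
           → μ≤ p k → μ≤ q l → μ≤ (∨-L p q) (suc (k + l))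
  ∨-R₁   : ∀ {Γ Δ B D} {p : Γ ⟶ B ∷ Δ} {k} → μ≤ p k → μ≤ (∨-R₁ {D = D} p) k
  ∨-R₂   : ∀ {Γ Δ B D} {p : Γ ⟶ D ∷ Δ} {k} → μ≤ p k → μ≤ (∨-R₂ {B = B} p) k
  ⊃-L    : ∀ {Γ Δ Θ B D} {p : (B `⊃ D) ∷ Γ ⟶ B ∷ Δ} {q : D ∷ Γ ⟶ Θ} {k l}
           → μ≤ p k → μ≤ q l → μ≤ (⊃-L p q) (k + l)
  ⊃-R-c  : ∀ {Γ Δ B D} {p : B ∷ Γ ⟶ D ∷ Δ} {k}
           → ConstrImp Γ B D → μ≤ p k → μ≤ (⊃-R p) k
  ⊃-R-n  : ∀ {Γ Δ B D} {p : B ∷ Γ ⟶ D ∷ Δ} {k} → μ≤ p k → μ≤ (⊃-R p) (suc k)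
  ∀-L    : ∀ {Γ Δ B t ct} {p : ([ t /x] B) ∷ (`∀ B) ∷ Γ ⟶ Δ} {k}
           → μ≤ p k → μ≤ (∀-L t ct p) k
  ∃-R    : ∀ {Γ Δ B t ct} {p : Γ ⟶ ([ t /x] B) ∷ Δ} {k}
           → μ≤ p k → μ≤ (∃-R t ct p) k
  ∃-L    : ∀ {Γ Δ B c h₁ h₂} {p : ([ con c /x] B) ∷ Γ ⟶ Δ} {k}
           → μ≤ p k → μ≤ (∃-L c h₁ h₂ p) k
  ∀-R    : ∀ {Γ Δ B c h₁ h₂} {p : Γ ⟶ ([ con c /x] B) ∷ Δ} {k}
           → μ≤ p k → μ≤ (∀-R c h₁ h₂ p) k
  weaken : ∀ {Γ Δ} {p : Γ ⟶ Δ} {k l} → k ≤ l → μ≤ p k → μ≤ p l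

infix 4 _≽_ _≽ₘ_

data _≽_ : Formula → Formula → Set where
  ≽-refl : ∀ {F} → F ≽ F
  ≽-⊃    : ∀ {F A B} → F ≽ B → F ≽ (A `⊃ B)
  ≽-∨₁   : ∀ {F A B} → F ≽ A → F ≽ (A `∨ B)
  ≽-∨₂   : ∀ {F A B} → F ≽ B → F ≽ (A `∨ B)
  ≽-∃    : ∀ {F P} (c : ℕ) → F ≽ ([ con c /x] P) → F ≽ `∃ P

_≽ₘ_ : List Formula → List Formula → Set
Γ₁ ≽ₘ Γ₂ = Σ (Fin (length Γ₂) → Fin (length Γ₁)) λ κ →
             Injective _≡_ _≡_ κ × (∀ i → lookup Γ₁ (κ i) ≽ lookup Γ₂ i)

{-# OPTIONS --safe #-}
-- The derivation of Γ ⟶ Δ is replayed over Γ', each formula F of Γ' standing in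
-- for the formula A of Γ that it dominates. Where F ≽ A strictly, a left rule on A
-- is not replayed: for A = B ∨ D or B ⊃ D only the premise containing the
-- subformula that F still dominates is kept (for ⊃-L the succedent of the dropped
-- premise is then added as a right weakening), and for A = ∃xP with F ≽ [c/x]P the
-- eigenvariable of ∃-L is renamed to c. The induction therefore runs over an
-- arbitrary renaming of constants and an arbitrary right weakening, with fresh
-- eigenvariables for the replayed ∃-L and ∀-R. A replayed ∨-L or ⊃-R stays
-- constructive because its witnessing I-proofs are transported by the same
-- construction, and dropping an ∨-L or ⊃-L can only lower μ.
module Submission where

open import Defs
open import Data.Nat using (ℕ; suc; _≤_; _⊔_; _≟_; _≡ᵇ_; _<ᵇ_)
open import Data.Nat.Properties using (≤-refl; ≤-trans; m≤m⊔n; m≤n⊔m; 1+n≰n; m≤m+n; m≤n+m; m≤n⇒m≤1+n)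
open import Data.Bool using (true; false)
open import Data.Fin using (Fin; zero; suc)
open import Data.Fin.Properties using (suc-injective)
open import Data.List using (List; []; _∷_; _++_; length; lookup; map)
open import Data.List.Properties using (map-++; length-map; ++-identityʳ; ++-assoc)
open import Data.List.Membership.Propositional using (_∈_)
open import Data.List.Membership.Propositional.Properties using (∈-map⁺; ∈-++⁺ˡ)
open import Data.List.Relation.Unary.Any using (Any; here; there)
import Data.List.Relation.Unary.Any.Properties as Any
open import Data.List.Relation.Binary.Permutation.Propositional using (_↭_; ↭-refl; ↭-prep; ↭-swap; ↭-sym; ↭-trans; ↭-reflexive)
import Data.List.Relation.Binary.Permutation.Propositional as ↭
open import Data.List.Relation.Binary.Permutation.Propositional.Properties using (++⁺ʳ; map⁺; shifts)
open import Data.List.Relation.Binary.Prefix.Heterogeneous using (Prefix; []; _∷_)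
import Data.List.Relation.Binary.Prefix.Heterogeneous as Prefix
open import Data.Empty using (⊥-elim)
open import Data.Unit using (tt)
open import Data.Sum using (inj₁; inj₂)
open import Data.Product using (Σ; ∃-syntax; _×_; _,_)
open import Function using (id; _∘_)
open import Function.Definitions using (Injective)
open import Relation.Binary.Core using (REL)
open import Relation.Binary.PropositionalEquality using (_≡_; _≢_; refl; sym; trans; cong; cong₂; subst; module ≡-Reasoning)
open import Relation.Nullary using (¬_; yes; no)

mutual
  renT : (ℕ → ℕ) → Term → Term
  renT ρ (var n)    = var n
  renT ρ (con c)    = con (ρ c)
  renT ρ (fun f ts) = fun f (renTs ρ ts)

  renTs : (ℕ → ℕ) → List Term → List Term
  renTs ρ []       = []
  renTs ρ (t ∷ ts) = renT ρ t ∷ renTs ρ ts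

renF : (ℕ → ℕ) → Formula → Formula
renF ρ (atom p ts) = atom p (renTs ρ ts)
renF ρ `⊤          = `⊤
renF ρ `⊥          = `⊥
renF ρ (A `∧ B)    = renF ρ A `∧ renF ρ B
renF ρ (A `∨ B)    = renF ρ A `∨ renF ρ B
renF ρ (A `⊃ B)    = renF ρ A `⊃ renF ρ B
renF ρ (`∃ A)      = `∃ (renF ρ A)
renF ρ (`∀ A)      = `∀ (renF ρ A)

mutual
  renT-substT : ∀ ρ d s t → renT ρ (substT d s t) ≡ substT d (renT ρ s) (renT ρ t)
  renT-substT ρ d s (var n) with n ≡ᵇ d | n <ᵇ d
  ... | true  | _     = refl
  ... | false | true  = refl
  ... | false | false = refl
  renT-substT ρ d s (con c)    = refl
  renT-substT ρ d s (fun f ts) = cong (fun f) (renTs-substTs ρ d s ts)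

  renTs-substTs : ∀ ρ d s ts → renTs ρ (substTs d s ts) ≡ substTs d (renT ρ s) (renTs ρ ts)
  renTs-substTs ρ d s []       = refl
  renTs-substTs ρ d s (t ∷ ts) = cong₂ _∷_ (renT-substT ρ d s t) (renTs-substTs ρ d s ts)

renF-substF : ∀ ρ d s A → renF ρ (substF d s A) ≡ substF d (renT ρ s) (renF ρ A)
renF-substF ρ d s (atom p ts) = cong (atom p) (renTs-substTs ρ d s ts)
renF-substF ρ d s `⊤          = refl
renF-substF ρ d s `⊥          = refl
renF-substF ρ d s (A `∧ B)    = cong₂ _`∧_ (renF-substF ρ d s A) (renF-substF ρ d s B)
renF-substF ρ d s (A `∨ B)    = cong₂ _`∨_ (renF-substF ρ d s A) (renF-substF ρ d s B)
renF-substF ρ d s (A `⊃ B)    = cong₂ _`⊃_ (renF-substF ρ d s A) (renF-substF ρ d s B)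
renF-substF ρ d s (`∃ A)      = cong `∃ (renF-substF ρ (suc d) s A)
renF-substF ρ d s (`∀ A)      = cong `∀ (renF-substF ρ (suc d) s A)

mutual
  ClosedT-renT : ∀ ρ t → ClosedT t → ClosedT (renT ρ t)
  ClosedT-renT ρ (con c)    _ = tt
  ClosedT-renT ρ (fun f ts) h = ClosedTs-renTs ρ ts h

  ClosedTs-renTs : ∀ ρ ts → ClosedTs ts → ClosedTs (renTs ρ ts)
  ClosedTs-renTs ρ []       _        = tt
  ClosedTs-renTs ρ (t ∷ ts) (h , hs) = ClosedT-renT ρ t h , ClosedTs-renTs ρ ts hs

mutual
  renT-cong : ∀ ρ σ t → (∀ x → OccT x t → ρ x ≡ σ x) → renT ρ t ≡ renT σ t
  renT-cong ρ σ (var n)    h = refl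
  renT-cong ρ σ (con c)    h = cong con (h c refl)
  renT-cong ρ σ (fun f ts) h = cong (fun f) (renTs-cong ρ σ ts h)

  renTs-cong : ∀ ρ σ ts → (∀ x → OccTs x ts → ρ x ≡ σ x) → renTs ρ ts ≡ renTs σ ts
  renTs-cong ρ σ []       h = refl
  renTs-cong ρ σ (t ∷ ts) h =
    cong₂ _∷_ (renT-cong ρ σ t (λ x → h x ∘ inj₁)) (renTs-cong ρ σ ts (λ x → h x ∘ inj₂))

renF-cong : ∀ ρ σ A → (∀ x → OccF x A → ρ x ≡ σ x) → renF ρ A ≡ renF σ A
renF-cong ρ σ (atom p ts) h = cong (atom p) (renTs-cong ρ σ ts h)
renF-cong ρ σ `⊤          h = refl
renF-cong ρ σ `⊥          h = refl
renF-cong ρ σ (A `∧ B)    h = cong₂ _`∧_ (renF-cong ρ σ A (λ x → h x ∘ inj₁)) (renF-cong ρ σ B (λ x → h x ∘ inj₂))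
renF-cong ρ σ (A `∨ B)    h = cong₂ _`∨_ (renF-cong ρ σ A (λ x → h x ∘ inj₁)) (renF-cong ρ σ B (λ x → h x ∘ inj₂))
renF-cong ρ σ (A `⊃ B)    h = cong₂ _`⊃_ (renF-cong ρ σ A (λ x → h x ∘ inj₁)) (renF-cong ρ σ B (λ x → h x ∘ inj₂))
renF-cong ρ σ (`∃ A)      h = cong `∃ (renF-cong ρ σ A h)
renF-cong ρ σ (`∀ A)      h = cong `∀ (renF-cong ρ σ A h)

mutual
  renT-id : ∀ t → renT id t ≡ t
  renT-id (var n)    = refl
  renT-id (con c)    = refl
  renT-id (fun f ts) = cong (fun f) (renTs-id ts)

  renTs-id : ∀ ts → renTs id ts ≡ ts
  renTs-id []       = refl
  renTs-id (t ∷ ts) = cong₂ _∷_ (renT-id t) (renTs-id ts)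

renF-id : ∀ A → renF id A ≡ A
renF-id (atom p ts) = cong (atom p) (renTs-id ts)
renF-id `⊤          = refl
renF-id `⊥          = refl
renF-id (A `∧ B)    = cong₂ _`∧_ (renF-id A) (renF-id B)
renF-id (A `∨ B)    = cong₂ _`∨_ (renF-id A) (renF-id B)
renF-id (A `⊃ B)    = cong₂ _`⊃_ (renF-id A) (renF-id B)
renF-id (`∃ A)      = cong `∃ (renF-id A)
renF-id (`∀ A)      = cong `∀ (renF-id A)

map-renF-id : ∀ Δ → map (renF id) Δ ≡ Δ
map-renF-id []      = refl
map-renF-id (A ∷ Δ) = cong₂ _∷_ (renF-id A) (map-renF-id Δ)

infixl 6 _[_]≔_

_[_]≔_ : (ℕ → ℕ) → ℕ → ℕ → ℕ → ℕ
(ρ [ c ]≔ d) x with x ≟ c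
... | yes _ = d
... | no  _ = ρ x

[]≔-updated : ∀ ρ c d → (ρ [ c ]≔ d) c ≡ d
[]≔-updated ρ c d with c ≟ c
... | yes _   = refl
... | no  c≢c = ⊥-elim (c≢c refl)

[]≔-unchanged : ∀ ρ c d x → x ≢ c → (ρ [ c ]≔ d) x ≡ ρ x
[]≔-unchanged ρ c d x x≢c with x ≟ c
... | yes x≡c = ⊥-elim (x≢c x≡c)
... | no  _   = refl

renF-[]≔-# : ∀ ρ c d A → ¬ OccF c A → renF (ρ [ c ]≔ d) A ≡ renF ρ A
renF-[]≔-# ρ c d A c∉A = renF-cong _ _ A λ x x∈A → []≔-unchanged ρ c d x λ { refl → c∉A x∈A }

map-renF-[]≔-# : ∀ ρ c d Δ → c # Δ → map (renF (ρ [ c ]≔ d)) Δ ≡ map (renF ρ) Δ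
map-renF-[]≔-# ρ c d []      c#Δ = refl
map-renF-[]≔-# ρ c d (A ∷ Δ) c#Δ =
  cong₂ _∷_ (renF-[]≔-# ρ c d A (c#Δ ∘ here)) (map-renF-[]≔-# ρ c d Δ (c#Δ ∘ there))

renF-[]≔-instance : ∀ ρ c d B → ¬ OccF c B → renF (ρ [ c ]≔ d) ([ con c /x] B) ≡ [ con d /x] renF ρ B
renF-[]≔-instance ρ c d B c∉B = begin
  renF (ρ [ c ]≔ d) ([ con c /x] B)              ≡⟨ renF-substF (ρ [ c ]≔ d) 0 (con c) B ⟩
  [ con ((ρ [ c ]≔ d) c) /x] renF (ρ [ c ]≔ d) B ≡⟨ cong₂ (λ c' B' → [ con c' /x] B') ([]≔-updated ρ c d) (renF-[]≔-# ρ c d B c∉B) ⟩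
  [ con d /x] renF ρ B                           ∎
  where open ≡-Reasoning

mutual
  maxConT : Term → ℕ
  maxConT (var n)    = 0
  maxConT (con c)    = c
  maxConT (fun f ts) = maxConTs ts

  maxConTs : List Term → ℕ
  maxConTs []       = 0
  maxConTs (t ∷ ts) = maxConT t ⊔ maxConTs ts

maxConF : Formula → ℕ
maxConF (atom p ts) = maxConTs ts
maxConF `⊤          = 0
maxConF `⊥          = 0
maxConF (A `∧ B)    = maxConF A ⊔ maxConF B
maxConF (A `∨ B)    = maxConF A ⊔ maxConF B
maxConF (A `⊃ B)    = maxConF A ⊔ maxConF B
maxConF (`∃ A)      = maxConF A
maxConF (`∀ A)      = maxConF A

maxCon : List Formula → ℕ
maxCon []      = 0
maxCon (A ∷ Γ) = maxConF A ⊔ maxCon Γ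

mutual
  OccT⇒≤maxConT : ∀ x t → OccT x t → x ≤ maxConT t
  OccT⇒≤maxConT x (con c)    refl = ≤-refl
  OccT⇒≤maxConT x (fun f ts) o    = OccTs⇒≤maxConTs x ts o

  OccTs⇒≤maxConTs : ∀ x ts → OccTs x ts → x ≤ maxConTs ts
  OccTs⇒≤maxConTs x (t ∷ ts) (inj₁ o) = ≤-trans (OccT⇒≤maxConT x t o) (m≤m⊔n _ _)
  OccTs⇒≤maxConTs x (t ∷ ts) (inj₂ o) = ≤-trans (OccTs⇒≤maxConTs x ts o) (m≤n⊔m _ _)

OccF⇒≤maxConF : ∀ x A → OccF x A → x ≤ maxConF A
OccF⇒≤maxConF x (atom p ts) o        = OccTs⇒≤maxConTs x ts o
OccF⇒≤maxConF x (A `∧ B)    (inj₁ o) = ≤-trans (OccF⇒≤maxConF x A o) (m≤m⊔n _ _)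
OccF⇒≤maxConF x (A `∧ B)    (inj₂ o) = ≤-trans (OccF⇒≤maxConF x B o) (m≤n⊔m _ _)
OccF⇒≤maxConF x (A `∨ B)    (inj₁ o) = ≤-trans (OccF⇒≤maxConF x A o) (m≤m⊔n _ _)
OccF⇒≤maxConF x (A `∨ B)    (inj₂ o) = ≤-trans (OccF⇒≤maxConF x B o) (m≤n⊔m _ _)
OccF⇒≤maxConF x (A `⊃ B)    (inj₁ o) = ≤-trans (OccF⇒≤maxConF x A o) (m≤m⊔n _ _)
OccF⇒≤maxConF x (A `⊃ B)    (inj₂ o) = ≤-trans (OccF⇒≤maxConF x B o) (m≤n⊔m _ _)
OccF⇒≤maxConF x (`∃ A)      o        = OccF⇒≤maxConF x A o
OccF⇒≤maxConF x (`∀ A)      o        = OccF⇒≤maxConF x A o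

Occ⇒≤maxCon : ∀ x Γ → Any (OccF x) Γ → x ≤ maxCon Γ
Occ⇒≤maxCon x (A ∷ Γ) (here o)  = ≤-trans (OccF⇒≤maxConF x A o) (m≤m⊔n _ _)
Occ⇒≤maxCon x (A ∷ Γ) (there o) = ≤-trans (Occ⇒≤maxCon x Γ o) (m≤n⊔m _ _)

fresh : List Formula → ℕ
fresh Γ = suc (maxCon Γ)

fresh-# : ∀ Γ → fresh Γ # Γ
fresh-# Γ = 1+n≰n ∘ Occ⇒≤maxCon _ Γ

module _ {a b r} {A : Set a} {B : Set b} {R : REL A B r} where

  Prefix-↭ : ∀ {as as' bs} → as ↭ as' → Prefix R as bs → ∃[ bs' ] Prefix R as' bs' × bs ↭ bs'
  Prefix-↭ ↭.refl          rs           = _ , rs , ↭-refl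
  Prefix-↭ (↭.prep x π)    (r ∷ rs)     with Prefix-↭ π rs
  ... | _ , rs' , σ = _ , r ∷ rs' , ↭-prep _ σ
  Prefix-↭ (↭.swap x y π)  (r ∷ s ∷ rs) with Prefix-↭ π rs
  ... | _ , rs' , σ = _ , s ∷ r ∷ rs' , ↭-swap _ _ σ
  Prefix-↭ (↭.trans π₁ π₂) rs           with Prefix-↭ π₁ rs
  ... | _ , rs₁ , σ₁ with Prefix-↭ π₂ rs₁
  ... | _ , rs₂ , σ₂ = _ , rs₂ , ↭-trans σ₁ σ₂

infix 4 _≽[_]_

_≽[_]_ : List Formula → (ℕ → ℕ) → List Formula → Set
Γ' ≽[ ρ ] Γ = Prefix (λ A F → F ≽ renF ρ A) Γ Γ'

≽-reflexive : ∀ {F A} → F ≡ A → F ≽ A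
≽-reflexive refl = ≽-refl

BotOrAtom-renF : ∀ {ρ A} → BotOrAtom A → BotOrAtom (renF ρ A)
BotOrAtom-renF isBot         = isBot
BotOrAtom-renF (isAtom p ts) = isAtom p _

BotOrAtom-≽⇒≡ : ∀ {F A} → BotOrAtom A → F ≽ A → F ≡ A
BotOrAtom-≽⇒≡ isBot         ≽-refl = refl
BotOrAtom-≽⇒≡ (isAtom p ts) ≽-refl = refl

≽[]-∈ : ∀ {ρ Γ Γ' A} → Γ' ≽[ ρ ] Γ → BotOrAtom A → A ∈ Γ → renF ρ A ∈ Γ'
≽[]-∈ (F≽A ∷ _) a (here refl) = here (sym (BotOrAtom-≽⇒≡ (BotOrAtom-renF a) F≽A))
≽[]-∈ (_ ∷ e)   a (there A∈Γ) = there (≽[]-∈ e a A∈Γ)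

≽[]-[]≔ : ∀ {ρ Γ Γ'} c d → c # Γ → Γ' ≽[ ρ ] Γ → Γ' ≽[ ρ [ c ]≔ d ] Γ
≽[]-[]≔ c d c#Γ [] = []
≽[]-[]≔ {ρ} c d c#Γ (_∷_ {a = A} F≽A e) =
  subst (_ ≽_) (sym (renF-[]≔-# ρ c d A (c#Γ ∘ here))) F≽A ∷ ≽[]-[]≔ c d (c#Γ ∘ there) e

castR : ∀ {Γ Δ Δ'} → Δ ≡ Δ' → Γ ⟶ Δ → Γ ⟶ Δ'
castR Δ≡Δ' = exch-R (↭-reflexive Δ≡Δ')

map-++-++ : ∀ {a b} {A : Set a} {B : Set b} (f : A → B) xs ys zs →
            map f xs ++ map f ys ++ zs ≡ map f (xs ++ ys) ++ zs
map-++-++ f xs ys zs = begin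
  map f xs ++ map f ys ++ zs   ≡⟨ ++-assoc (map f xs) (map f ys) zs ⟨
  (map f xs ++ map f ys) ++ zs ≡⟨ cong (_++ zs) (map-++ f xs ys) ⟨
  map f (xs ++ ys) ++ zs       ∎
  where open ≡-Reasoning

transport : ∀ {ρ Γ Γ' Δ} → Γ ⟶ Δ → ∀ W → Γ' ≽[ ρ ] Γ → Γ' ⟶ map (renF ρ) Δ ++ W
transport {ρ} (ax-⊤ ⊤∈Δ) W e = ax-⊤ (∈-++⁺ˡ (∈-map⁺ (renF ρ) ⊤∈Δ))
transport {ρ} (ax a A∈Γ A∈Δ) W e = ax (BotOrAtom-renF a) (≽[]-∈ e a A∈Γ) (∈-++⁺ˡ (∈-map⁺ (renF ρ) A∈Δ))
transport (exch-L π p) W e =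
  let (_ , e' , σ) = Prefix-↭ (↭-sym π) e in exch-L (↭-sym σ) (transport p W e')
transport {ρ} (exch-R π p) W e = exch-R (++⁺ʳ W (map⁺ (renF ρ) π)) (transport p W e)
transport (contr-L p) W (F≽B ∷ e) = contr-L (transport p W (F≽B ∷ F≽B ∷ e))
transport (contr-R p) W e = contr-R (transport p W e)
transport (⊥-R p) W e = ⊥-R (transport p W e)
transport (∧-L p) W (≽-refl ∷ e) = ∧-L (transport p W (≽-refl ∷ ≽-refl ∷ ≽-refl ∷ e))
transport (∧-R p q) W e = ∧-R (transport p W e) (transport q W e)
transport (∨-L p q) W (≽-refl ∷ e) = ∨-L (transport p W (≽-refl ∷ e)) (transport q W (≽-refl ∷ e))
transport (∨-L p q) W (≽-∨₁ F≽B ∷ e) = transport p W (F≽B ∷ e)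
transport (∨-L p q) W (≽-∨₂ F≽D ∷ e) = transport q W (F≽D ∷ e)
transport (∨-R₁ p) W e = ∨-R₁ (transport p W e)
transport (∨-R₂ p) W e = ∨-R₂ (transport p W e)
transport {ρ} (⊃-L {Δ = Δ} {Θ} p q) W (≽-refl ∷ e) =
  castR reassociate (⊃-L (transport p [] (≽-refl ∷ e)) (transport q W (≽-refl ∷ e)))
  where
  reassociate : (map (renF ρ) Δ ++ []) ++ map (renF ρ) Θ ++ W ≡ map (renF ρ) (Δ ++ Θ) ++ W
  reassociate = trans (cong (_++ map (renF ρ) Θ ++ W) (++-identityʳ (map (renF ρ) Δ))) (map-++-++ (renF ρ) Δ Θ W)
transport {ρ} (⊃-L {Δ = Δ} {Θ} p q) W (≽-⊃ F≽D ∷ e) =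
  exch-R reorder (transport q (map (renF ρ) Δ ++ W) (F≽D ∷ e))
  where
  reorder : map (renF ρ) Θ ++ map (renF ρ) Δ ++ W ↭ map (renF ρ) (Δ ++ Θ) ++ W
  reorder = ↭-trans (shifts (map (renF ρ) Θ) (map (renF ρ) Δ)) (↭-reflexive (map-++-++ (renF ρ) Δ Θ W))
transport (⊃-R p) W e = ⊃-R (transport p W (≽-refl ∷ e))
transport {ρ} (∀-L {B = B} t closed p) W (≽-refl ∷ e) =
  ∀-L (renT ρ t) (ClosedT-renT ρ t closed)
      (transport p W (≽-reflexive (sym (renF-substF ρ 0 t B)) ∷ ≽-refl ∷ e))
transport {ρ} (∃-R {B = B} t closed p) W e =
  ∃-R (renT ρ t) (ClosedT-renT ρ t closed) (castR (cong (_∷ _) (renF-substF ρ 0 t B)) (transport p W e))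
transport {ρ} {Γ' = Γ'} (∃-L {Δ = Δ} {B} c c#∃BΓ c#Δ p) W (≽-refl ∷ e) =
  ∃-L c' (fresh-# L ∘ Any.++⁺ˡ) (fresh-# L ∘ Any.++⁺ʳ Γ')
      (castR (cong (_++ W) (map-renF-[]≔-# ρ c c' Δ c#Δ))
             (transport p W (≽-reflexive (sym (renF-[]≔-instance ρ c c' B (c#∃BΓ ∘ here)))
                             ∷ ≽[]-[]≔ c c' (c#∃BΓ ∘ there) e)))
  where
  L = Γ' ++ map (renF ρ) Δ ++ W
  c' = fresh L
transport {ρ} (∃-L {Δ = Δ} {B} c c#∃BΓ c#Δ p) W (≽-∃ d F≽Bd ∷ e) =
  castR (cong (_++ W) (map-renF-[]≔-# ρ c d Δ c#Δ))
        (transport p W (subst (_ ≽_) (sym (renF-[]≔-instance ρ c d B (c#∃BΓ ∘ here))) F≽Bd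
                        ∷ ≽[]-[]≔ c d (c#∃BΓ ∘ there) e))
transport {ρ} {Γ' = Γ'} (∀-R {Δ = Δ} {B} c c#Γ c#∀BΔ p) W e =
  ∀-R c' (fresh-# L ∘ Any.++⁺ˡ) (fresh-# L ∘ Any.++⁺ʳ Γ')
      (castR (cong₂ _∷_ (renF-[]≔-instance ρ c c' B (c#∀BΔ ∘ here))
                        (cong (_++ W) (map-renF-[]≔-# ρ c c' Δ (c#∀BΔ ∘ there))))
             (transport p W (≽[]-[]≔ c c' c#Γ e)))
  where
  L = Γ' ++ map (renF ρ) (`∀ B ∷ Δ) ++ W
  c' = fresh L

length≡1-map-++[] : ∀ {a b} {A : Set a} {B : Set b} {f : A → B} xs → length xs ≡ 1 → length (map f xs ++ []) ≡ 1
length≡1-map-++[] {f = f} Δ l = trans (cong length (++-identityʳ (map f Δ))) (trans (length-map f Δ) l)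

transport-IsI : ∀ {ρ Γ Γ' Δ} {e : Γ' ≽[ ρ ] Γ} (Ξ : Γ ⟶ Δ) → IsI Ξ → IsI (transport Ξ [] e)
transport-IsI {Δ = Δ} (ax-⊤ _)       (l , _)     = length≡1-map-++[] Δ l , tt
transport-IsI {Δ = Δ} (ax _ _ _)     (l , _)     = length≡1-map-++[] Δ l , tt
transport-IsI {Δ = Δ} (exch-L _ p)   (l , i)     = length≡1-map-++[] Δ l , transport-IsI p i
transport-IsI {Δ = Δ} (exch-R _ p)   (l , i)     = length≡1-map-++[] Δ l , transport-IsI p i
transport-IsI {Δ = Δ} {e = _ ∷ _} (contr-L p) (l , i) = length≡1-map-++[] Δ l , transport-IsI p i
transport-IsI {Δ = Δ} (contr-R p)    (l , i)     = length≡1-map-++[] Δ l , transport-IsI p i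
transport-IsI {Δ = Δ} (⊥-R p)        (l , i)     = length≡1-map-++[] Δ l , transport-IsI p i
transport-IsI {Δ = Δ} {e = ≽-refl ∷ _} (∧-L p) (l , i) = length≡1-map-++[] Δ l , transport-IsI p i
transport-IsI {Δ = Δ} (∧-R p q)      (l , i , j) = length≡1-map-++[] Δ l , transport-IsI p i , transport-IsI q j
transport-IsI {Δ = Δ} {e = ≽-refl ∷ _} (∨-L p q) (l , i , j) = length≡1-map-++[] Δ l , transport-IsI p i , transport-IsI q j
transport-IsI {e = ≽-∨₁ _ ∷ _} (∨-L p q) (_ , i , _) = transport-IsI p i
transport-IsI {e = ≽-∨₂ _ ∷ _} (∨-L p q) (_ , _ , j) = transport-IsI q j
transport-IsI {Δ = Δ} (∨-R₁ p)       (l , i)     = length≡1-map-++[] Δ l , transport-IsI p i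
transport-IsI {Δ = Δ} (∨-R₂ p)       (l , i)     = length≡1-map-++[] Δ l , transport-IsI p i
-- The left premise of ⊃-L in an I-proof has succedent [ B ], so no right weakening arises.
transport-IsI (⊃-L {Δ = _ ∷ _} p q) (_ , (() , _) , _)
transport-IsI {Δ = Δ} {e = ≽-refl ∷ _} (⊃-L {Δ = []} p q) (l , i , j) =
  length≡1-map-++[] Δ l , length≡1-map-++[] Δ l , transport-IsI p i , transport-IsI q j
transport-IsI {Δ = Δ} {e = ≽-⊃ _ ∷ _} (⊃-L {Δ = []} p q) (l , _ , j) = length≡1-map-++[] Δ l , transport-IsI q j
transport-IsI {Δ = Δ} (⊃-R p)        (l , i)     = length≡1-map-++[] Δ l , transport-IsI p i
transport-IsI {Δ = Δ} {e = ≽-refl ∷ _} (∀-L _ _ p) (l , i) = length≡1-map-++[] Δ l , transport-IsI p i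
transport-IsI {Δ = Δ} (∃-R _ _ p)    (l , i)     = length≡1-map-++[] Δ l , length≡1-map-++[] Δ l , transport-IsI p i
transport-IsI {Δ = Δ} {e = ≽-refl ∷ _} (∃-L _ _ _ p) (l , i) =
  length≡1-map-++[] Δ l , length≡1-map-++[] Δ l , transport-IsI p i
transport-IsI {Δ = Δ} {e = ≽-∃ _ _ ∷ _} (∃-L _ _ _ p) (l , i) = length≡1-map-++[] Δ l , transport-IsI p i
transport-IsI {Δ = Δ} (∀-R _ _ _ p)  (l , i)     = length≡1-map-++[] Δ l , length≡1-map-++[] Δ l , transport-IsI p i

transport-HasIProof : ∀ {ρ Γ Γ' F} → Γ' ≽[ ρ ] Γ → HasIProof Γ F → HasIProof Γ' (renF ρ F)
transport-HasIProof e (Ξ , i) = transport Ξ [] e , transport-IsI Ξ i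

transport-ConstrOr : ∀ {ρ Γ Γ' Δ B D} W → Γ' ≽[ ρ ] Γ → ConstrOr Γ Δ B D →
                     ConstrOr Γ' (map (renF ρ) Δ ++ W) (renF ρ B) (renF ρ D)
transport-ConstrOr {ρ} W e (F , F∈Δ , hB , hD) =
  renF ρ F , ∈-++⁺ˡ (∈-map⁺ (renF ρ) F∈Δ) , transport-HasIProof (≽-refl ∷ e) hB , transport-HasIProof (≽-refl ∷ e) hD

transport-μ≤ : ∀ {ρ Γ Γ' Δ W k} {e : Γ' ≽[ ρ ] Γ} {Ξ : Γ ⟶ Δ} → μ≤ Ξ k → μ≤ (transport Ξ W e) k
transport-μ≤ ax-⊤        = ax-⊤
transport-μ≤ ax          = ax
transport-μ≤ (exch-L m)  = exch-L (transport-μ≤ m)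
transport-μ≤ (exch-R m)  = exch-R (transport-μ≤ m)
transport-μ≤ {e = _ ∷ _} (contr-L m) = contr-L (transport-μ≤ m)
transport-μ≤ (contr-R m) = contr-R (transport-μ≤ m)
transport-μ≤ (⊥-R m)     = ⊥-R (transport-μ≤ m)
transport-μ≤ {e = ≽-refl ∷ _} (∧-L m) = ∧-L (transport-μ≤ m)
transport-μ≤ (∧-R m n)   = ∧-R (transport-μ≤ m) (transport-μ≤ n)
transport-μ≤ {W = W} {e = ≽-refl ∷ e} (∨-L-c c m n) = ∨-L-c (transport-ConstrOr W e c) (transport-μ≤ m) (transport-μ≤ n)
transport-μ≤ {e = ≽-∨₁ _ ∷ _} (∨-L-c _ m _) = weaken (m≤m+n _ _) (transport-μ≤ m)
transport-μ≤ {e = ≽-∨₂ _ ∷ _} (∨-L-c _ _ n) = weaken (m≤n+m _ _) (transport-μ≤ n)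
transport-μ≤ {e = ≽-refl ∷ _} (∨-L-n m n) = ∨-L-n (transport-μ≤ m) (transport-μ≤ n)
transport-μ≤ {e = ≽-∨₁ _ ∷ _} (∨-L-n m _) = weaken (m≤n⇒m≤1+n (m≤m+n _ _)) (transport-μ≤ m)
transport-μ≤ {e = ≽-∨₂ _ ∷ _} (∨-L-n _ n) = weaken (m≤n⇒m≤1+n (m≤n+m _ _)) (transport-μ≤ n)
transport-μ≤ (∨-R₁ m)    = ∨-R₁ (transport-μ≤ m)
transport-μ≤ (∨-R₂ m)    = ∨-R₂ (transport-μ≤ m)
transport-μ≤ {e = ≽-refl ∷ _} (⊃-L m n) = exch-R (⊃-L (transport-μ≤ {W = []} m) (transport-μ≤ n))
transport-μ≤ {e = ≽-⊃ _ ∷ _}  (⊃-L _ n) = weaken (m≤n+m _ _) (exch-R (transport-μ≤ n))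
transport-μ≤ {e = e} (⊃-R-c c m) = ⊃-R-c (transport-HasIProof (≽-refl ∷ e) c) (transport-μ≤ m)
transport-μ≤ (⊃-R-n m)   = ⊃-R-n (transport-μ≤ m)
transport-μ≤ {e = ≽-refl ∷ _} (∀-L m) = ∀-L (transport-μ≤ m)
transport-μ≤ (∃-R m)     = ∃-R (exch-R (transport-μ≤ m))
transport-μ≤ {e = ≽-refl ∷ _} (∃-L m) = ∃-L (exch-R (transport-μ≤ m))
transport-μ≤ {e = ≽-∃ _ _ ∷ _} (∃-L m) = exch-R (transport-μ≤ m)
transport-μ≤ (∀-R m)     = ∀-R (exch-R (transport-μ≤ m))
transport-μ≤ (weaken k≤l m) = weaken k≤l (transport-μ≤ m)

HasIProof-↭ : ∀ {Γ Γ' F} → Γ ↭ Γ' → HasIProof Γ F → HasIProof Γ' F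
HasIProof-↭ π (Ξ , i) = exch-L π Ξ , refl , i

module _ {a} {A : Set a} where

  record Removal (xs : List A) (j : Fin (length xs)) : Set a where
    field
      rest            : List A
      ↭-rest          : xs ↭ lookup xs j ∷ rest
      index           : ∀ {i} → i ≢ j → Fin (length rest)
      lookup-index    : ∀ {i} (i≢j : i ≢ j) → lookup rest (index i≢j) ≡ lookup xs i
      index-injective : ∀ {i i'} (i≢j : i ≢ j) (i'≢j : i' ≢ j) → index i≢j ≡ index i'≢j → i ≡ i'

  remove : (xs : List A) (j : Fin (length xs)) → Removal xs j
  remove (x ∷ xs) zero = record
    { rest = xs ; ↭-rest = ↭-refl ; index = index ; lookup-index = lookup-index ; index-injective = index-injective }
    where
    index : ∀ {i} → i ≢ zero → Fin (length xs)
    index {zero}  0≢0 = ⊥-elim (0≢0 refl)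
    index {suc i} _   = i
    lookup-index : ∀ {i} (i≢0 : i ≢ zero) → lookup xs (index i≢0) ≡ lookup (x ∷ xs) i
    lookup-index {zero}  0≢0 = ⊥-elim (0≢0 refl)
    lookup-index {suc i} _   = refl
    index-injective : ∀ {i i'} (i≢0 : i ≢ zero) (i'≢0 : i' ≢ zero) → index i≢0 ≡ index i'≢0 → i ≡ i'
    index-injective {zero}          0≢0 _   _  = ⊥-elim (0≢0 refl)
    index-injective {suc _} {zero}  _   0≢0 _  = ⊥-elim (0≢0 refl)
    index-injective {suc _} {suc _} _   _   eq = cong suc eq
  remove (x ∷ xs) (suc j) = record
    { rest = x ∷ rest ; ↭-rest = ↭-trans (↭-prep x ↭-rest) (↭-swap x _ ↭-refl) ; index = index′
    ; lookup-index = lookup-index′ ; index-injective = index-injective′ }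
    where
    open Removal (remove xs j)
    index′ : ∀ {i} → i ≢ suc j → Fin (suc (length rest))
    index′ {zero}  _      = zero
    index′ {suc i} i≢j+1 = suc (index (i≢j+1 ∘ cong suc))
    lookup-index′ : ∀ {i} (i≢j+1 : i ≢ suc j) → lookup (x ∷ rest) (index′ i≢j+1) ≡ lookup (x ∷ xs) i
    lookup-index′ {zero}  _      = refl
    lookup-index′ {suc i} i≢j+1 = lookup-index (i≢j+1 ∘ cong suc)
    index-injective′ : ∀ {i i'} (i≢j+1 : i ≢ suc j) (i'≢j+1 : i' ≢ suc j) → index′ i≢j+1 ≡ index′ i'≢j+1 → i ≡ i'
    index-injective′ {zero}  {zero}  _ _ _  = refl
    index-injective′ {suc i} {suc i'} i≢j+1 i'≢j+1 eq =
      cong suc (index-injective (i≢j+1 ∘ cong suc) (i'≢j+1 ∘ cong suc) (suc-injective eq))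

module _ {a b r} {A : Set a} {B : Set b} (R : REL A B r) where

  injection⇒Prefix-↭ : ∀ as bs (κ : Fin (length as) → Fin (length bs)) → Injective _≡_ _≡_ κ →
                       (∀ i → R (lookup as i) (lookup bs (κ i))) → ∃[ bs' ] Prefix R as bs' × bs' ↭ bs
  injection⇒Prefix-↭ []       bs κ κ-inj κ-R = bs , [] , ↭-refl
  injection⇒Prefix-↭ (a ∷ as) bs κ κ-inj κ-R =
    let (bs' , rs , σ) = injection⇒Prefix-↭ as rest κ′ κ′-inj κ′-R
    in lookup bs (κ zero) ∷ bs' , κ-R zero ∷ rs , ↭-trans (↭-prep _ σ) (↭-sym ↭-rest)
    where
    open Removal (remove bs (κ zero))
    κ-suc≢κ-zero : ∀ i → κ (suc i) ≢ κ zero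
    κ-suc≢κ-zero i eq with () ← κ-inj eq
    κ′ : Fin (length as) → Fin (length rest)
    κ′ i = index (κ-suc≢κ-zero i)
    κ′-inj : Injective _≡_ _≡_ κ′
    κ′-inj {i} {i'} eq = suc-injective (κ-inj (index-injective (κ-suc≢κ-zero i) (κ-suc≢κ-zero i') eq))
    κ′-R : ∀ i → R (lookup as i) (lookup rest (κ′ i))
    κ′-R i = subst (R (lookup as i)) (sym (lookup-index (κ-suc≢κ-zero i))) (κ-R (suc i))

≽ₘ⇒≽[id]-↭ : ∀ {Γ Γ'} → Γ' ≽ₘ Γ → ∃[ Γ₁ ] Γ₁ ≽[ id ] Γ × Γ₁ ↭ Γ'
≽ₘ⇒≽[id]-↭ {Γ} {Γ'} (κ , κ-inj , κ-≽) with Γ₁ , rs , σ ← injection⇒Prefix-↭ (λ A F → F ≽ A) Γ Γ' κ κ-inj κ-≽ =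
  Γ₁ , Prefix.map (λ {A} → subst (_ ≽_) (sym (renF-id A))) rs , σ

lemma5 : (Γ Γ' : List Formula) → Γ' ≽ₘ Γ
       → ((F : Formula) → HasIProof Γ F → HasIProof Γ' F)
       × ((Δ : List Formula) (Ξ : Γ ⟶ Δ) (k : ℕ) → μ≤ Ξ k
          → Σ (Γ' ⟶ Δ) λ Ξ' → μ≤ Ξ' k)
lemma5 Γ Γ' Γ'≽Γ with Γ₁ , Γ₁≽Γ , Γ₁↭Γ' ← ≽ₘ⇒≽[id]-↭ Γ'≽Γ = I-proofs , C-proofs
  where
  I-proofs : (F : Formula) → HasIProof Γ F → HasIProof Γ' F
  I-proofs F h = HasIProof-↭ Γ₁↭Γ' (subst (HasIProof Γ₁) (renF-id F) (transport-HasIProof Γ₁≽Γ h))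
  C-proofs : (Δ : List Formula) (Ξ : Γ ⟶ Δ) (k : ℕ) → μ≤ Ξ k → Σ (Γ' ⟶ Δ) λ Ξ' → μ≤ Ξ' k
  C-proofs Δ Ξ k m = castR (trans (++-identityʳ _) (map-renF-id Δ)) (exch-L Γ₁↭Γ' (transport Ξ [] Γ₁≽Γ))
                   , exch-R (exch-L (transport-μ≤ m))
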